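{- Let $n\ge 1$. The power graph $P(A_{n})$ of the alternating group $A_n$ is $\{P_{5}, \overline{P_{5}}\}$-free if and only if $n\leq 6$.
   Context: The power graph $P(G)$ of a group $G$ has vertex set $G$, with distinct $u,v$ adjacent if and only if $u=v^m$ or $v=u^n$ for some positive integers $m,n$. $P_5$ is the path on $5$ vertices and $\overline{P_5}$ its complement. A graph is $\{H_1,H_2\}$-free if it contains no induced subgraph isomorphic to $H_1$ and none isomorphic to $H_2$. -}

module Defs where

open import Data.Nat using (ℕ; zero; suc; _≤_; _+_)
open import Data.Nat.Divisibility using (_∣_)
open import Data.Fin using (Fin; toℕ; _<?_)
open import Data.List using (List; map; allFin)
open import Data.Nat.ListAction using (sum)
open import Data.Product using (Σ; _×_; ∃; proj₁)
open import Data.Sum using (_⊎_)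
open import Data.Bool using (if_then_else_; _∧_)
open import Function using (id; _∘_)
open import Function.Definitions using (Injective)
open import Relation.Nullary using (¬_)
open import Relation.Nullary.Decidable using (⌊_⌋)
open import Relation.Binary.PropositionalEquality using (_≡_; _≢_)
open import Function.Bundles using (_⇔_)

inversions : {n : ℕ} → (Fin n → Fin n) → ℕ
inversions {n} f =
  sum (map (λ i → sum (map (λ j → if ⌊ i <? j ⌋ ∧ ⌊ f j <? f i ⌋ then 1 else 0)
                           (allFin n)))
           (allFin n))

-- Elements of the alternating group A_n: injective (hence bijective)
-- maps Fin n → Fin n with an even number of inversions.
Alt : ℕ → Set
Alt n = Σ (Fin n → Fin n) (λ f → Injective _≡_ _≡_ f × 2 ∣ inversions f)

_≈ₐ_ : {n : ℕ} → Alt n → Alt n → Set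
_≈ₐ_ {n} σ τ = (i : Fin n) → proj₁ σ i ≡ proj₁ τ i

power : {n : ℕ} → (Fin n → Fin n) → ℕ → (Fin n → Fin n)
power f zero = id
power f (suc m) = f ∘ power f m

IsPowerOf : {n : ℕ} → Alt n → Alt n → Set
IsPowerOf u v = ∃ λ m → 1 ≤ m × ((i : Fin _) → proj₁ u i ≡ power (proj₁ v) m i)

PowAdj : {n : ℕ} → Alt n → Alt n → Set
PowAdj u v = ¬ (u ≈ₐ v) × (IsPowerOf u v ⊎ IsPowerOf v u)

P5Adj : Fin 5 → Fin 5 → Set
P5Adj i j = toℕ j ≡ suc (toℕ i) ⊎ toℕ i ≡ suc (toℕ j)

coP5Adj : Fin 5 → Fin 5 → Set
coP5Adj i j = i ≢ j × ¬ P5Adj i j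

HasInduced : (n : ℕ) → (Fin 5 → Fin 5 → Set) → Set
HasInduced n H = Σ (Fin 5 → Alt n) λ f →
  ((i j : Fin 5) → i ≢ j → ¬ (f i ≈ₐ f j)) ×
  ((i j : Fin 5) → i ≢ j → (PowAdj (f i) (f j) ⇔ H i j))

PowerGraphP5coP5Free : ℕ → Set
PowerGraphP5coP5Free n = ¬ HasInduced n P5Adj × ¬ HasInduced n coP5Adj

-- Every element g of A₆ satisfies g³ = 1, g⁴ = 1 or g⁵ = 1, and in a cyclic group of order 3, 4
-- or 5, of any two elements one is a power of the other.  Hence in P(A₆) the middle vertex of an
-- induced path u – v – w is a power of both u and w; along an induced path a – b – c – d this makes
-- b a power of c and c a power of d, so b is a power of d.  Thus P(A₆) has no induced P₄, while P₅
-- and its complement both contain one.  Fixing a new point embeds P(A_m) into P(A_(m+1)) as an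
-- induced subgraph, which settles n ≤ 6.  For n ≥ 7, with c = (0 1 2), t = (3 4)(5 6) and
-- s = (3 5)(4 6), the elements t, ct, c, cs, s induce a P₅ in P(A₇): ct and cs have order 6, with
-- cubes t and s and fourth powers c.
module Submission where

open import Defs
open import Level using (0ℓ)
open import Data.Nat
  using (ℕ; zero; suc; s≤s; z≤n; _+_; _*_; _%_; _/_; _≤_; _≤′_; ≤′-refl; ≤′-step;
         NonZero; >-nonZero⁻¹)
import Data.Nat as ℕ
open import Data.Nat.Properties using (*-mono-≤; ≤-trans; m≤m+n; ≮⇒≥; ≤⇒≤′)
open import Data.Nat.DivMod using (m≡m%n+[m/n]*n; m%n%n≡m%n; %-distribˡ-*; m%n<n; _mod_)
open import Data.Nat.Divisibility using (_∣_; _∣?_)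
open import Data.Nat.ListAction using (sum)
open import Data.Fin using (Fin; zero; suc; toℕ; lift; _<?_; _≟_; #_)
open import Data.Fin.Properties using (all?; any?; suc-injective; toℕ-fromℕ<; lift-injective)
open import Data.Vec using (Vec; []; _∷_; lookup; tabulate)
open import Data.Vec.Properties using (lookup∘tabulate)
open import Data.Vec.Relation.Unary.All as All using (All; []; _∷_)
open import Data.Vec.Relation.Unary.AllPairs using ([]; _∷_)
open import Data.Vec.Relation.Unary.Unique.Propositional using (Unique)
open import Data.Vec.Relation.Unary.Unique.Propositional.Properties using (tabulate⁺)
open import Data.List using (List; []; _∷_; map; allFin)
open import Data.List.Properties using (map-cong; map-tabulate)
open import Data.Bool using (if_then_else_; _∧_)
open import Data.Unit using (⊤; tt)
open import Data.Empty using (⊥; ⊥-elim)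
open import Data.Product using (∃; _×_; _,_; proj₁; proj₂)
open import Data.Sum using (_⊎_; inj₁; inj₂)
import Data.Sum as Sum
open import Data.Sum.Function.Propositional using (_⊎-⇔_)
open import Data.Product.Function.NonDependent.Propositional using (_×-⇔_)
open import Function using (id; _∘_)
open import Function.Bundles using (_⇔_; mk⇔; Equivalence)
open import Function.Properties.Equivalence using () renaming (trans to ⇔-trans)
open import Function.Related.TypeIsomorphisms using (¬-cong-⇔)
open import Function.Definitions using (Injective)
open import Relation.Nullary using (¬_; Dec; yes; ¬?)
open import Relation.Nullary.Decidable
  using (⌊_⌋; isYes≗does; True; toWitness; map′; _×-dec_; _⊎-dec_; _→-dec_)
open import Relation.Unary using (Pred; Decidable)
open import Relation.Binary.Definitions using (Transitive)
open import Relation.Binary.PropositionalEquality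

Comparable : ∀ {a ℓ} {A : Set a} → (A → A → Set ℓ) → A → A → Set ℓ
Comparable R x y = R x y ⊎ R y x

module ChainDownSets {a ℓ} {A : Set a} (_≼_ : A → A → Set ℓ) (≼-trans : Transitive _≼_)
  (down-set-chain : ∀ {x y z} → x ≼ z → y ≼ z → Comparable _≼_ x y) where

  middle-below-ends : ∀ {x y z} → Comparable _≼_ x y → Comparable _≼_ y z →
                      ¬ Comparable _≼_ x z → y ≼ x × y ≼ z
  middle-below-ends (inj₂ y≼x) (inj₁ y≼z) _    = y≼x , y≼z
  middle-below-ends (inj₁ x≼y) (inj₁ y≼z) ¬x~z = ⊥-elim (¬x~z (inj₁ (≼-trans x≼y y≼z)))
  middle-below-ends (inj₂ y≼x) (inj₂ z≼y) ¬x~z = ⊥-elim (¬x~z (inj₂ (≼-trans z≼y y≼x)))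
  middle-below-ends (inj₁ x≼y) (inj₂ z≼y) ¬x~z = ⊥-elim (¬x~z (down-set-chain x≼y z≼y))

  no-induced-P₄ : ∀ {w x y z} → Comparable _≼_ w x → Comparable _≼_ x y → Comparable _≼_ y z →
                  ¬ Comparable _≼_ w y → ¬ Comparable _≼_ x z → ⊥
  no-induced-P₄ w~x x~y y~z ¬w~y ¬x~z =
    ¬x~z (inj₁ (≼-trans (proj₂ (middle-below-ends w~x x~y ¬w~y))
                        (proj₂ (middle-below-ends x~y y~z ¬x~z))))

module _ {n : ℕ} where

  power-cong : {f g : Fin n → Fin n} → f ≗ g → ∀ m → power f m ≗ power g m
  power-cong f≗g zero    i = refl
  power-cong {f} {g} f≗g (suc m) i = trans (cong f (power-cong f≗g m i)) (f≗g (power g m i))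

  power-+ : ∀ (f : Fin n → Fin n) a b → power f (a + b) ≗ power f a ∘ power f b
  power-+ f zero    b i = refl
  power-+ f (suc a) b i = cong f (power-+ f a b i)

  power-* : ∀ (f : Fin n → Fin n) a b → power (power f a) b ≗ power f (b * a)
  power-* f a zero    i = refl
  power-* f a (suc b) i = trans (cong (power f a) (power-* f a b i)) (sym (power-+ f a (b * a) i))

  power-*-id : ∀ (f : Fin n → Fin n) k → power f k ≗ id → ∀ q → power f (q * k) ≗ id
  power-*-id f k fᵏ≗id zero    i = refl
  power-*-id f k fᵏ≗id (suc q) i =
    trans (power-+ f k (q * k) i) (trans (cong (power f k) (power-*-id f k fᵏ≗id q i)) (fᵏ≗id i))

  power-% : ∀ (f : Fin n → Fin n) k .{{_ : NonZero k}} → power f k ≗ id →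
            ∀ m → power f m ≗ power f (m % k)
  power-% f k fᵏ≗id m i = begin
    power f m i                          ≡⟨ cong (λ e → power f e i) (m≡m%n+[m/n]*n m k) ⟩
    power f (m % k + q * k) i            ≡⟨ power-+ f (m % k) (q * k) i ⟩
    power f (m % k) (power f (q * k) i)  ≡⟨ cong (power f (m % k)) (power-*-id f k fᵏ≗id q i) ⟩
    power f (m % k) i                    ∎
    where
    open ≡-Reasoning
    q = m / k

  IsPowerOf-trans : {u v w : Alt n} → IsPowerOf u v → IsPowerOf v w → IsPowerOf u w
  IsPowerOf-trans {w = w} (a , 1≤a , u≗vᵃ) (b , 1≤b , v≗wᵇ) =
    a * b , *-mono-≤ 1≤a 1≤b ,
    λ i → trans (u≗vᵃ i) (trans (power-cong v≗wᵇ a i) (power-* (proj₁ w) b a i))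

-- i ≡ e * j (mod k) with the multiplier e = 1, …, k: every class of multipliers has such a
-- representative, and the bound makes the relation decidable.
MultipleMod : (k : ℕ) .{{_ : NonZero k}} → ℕ → ℕ → Set
MultipleMod k i j = ∃ λ (e : Fin k) → suc (toℕ e) * j % k ≡ i % k

multipleMod? : ∀ k .{{_ : NonZero k}} i j → Dec (MultipleMod k i j)
multipleMod? k i j = any? λ e → suc (toℕ e) * j % k ℕ.≟ i % k

MultipleMod-residues : ∀ k .{{_ : NonZero k}} {i j} →
                       MultipleMod k (i % k) (j % k) → MultipleMod k i j
MultipleMod-residues k {i} {j} (e , e[j%k]≡i%k%k) = e , (begin
  d * j % k                    ≡⟨ %-distribˡ-* d j k ⟩
  (d % k) * (j % k) % k        ≡⟨ cong (λ m → (d % k) * m % k) (sym (m%n%n≡m%n j k)) ⟩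
  (d % k) * (j % k % k) % k    ≡⟨ sym (%-distribˡ-* d (j % k) k) ⟩
  d * (j % k) % k              ≡⟨ e[j%k]≡i%k%k ⟩
  i % k % k                    ≡⟨ m%n%n≡m%n i k ⟩
  i % k                        ∎)
  where
  open ≡-Reasoning
  d = suc (toℕ e)

-- Holds exactly for prime powers k; only k = 3, 4, 5 are needed.
ChainModulus : (k : ℕ) .{{_ : NonZero k}} → Set
ChainModulus k = ∀ i j → Comparable (MultipleMod k) i j

ResiduesComparable : (k : ℕ) .{{_ : NonZero k}} → Set
ResiduesComparable k = ∀ (r s : Fin k) → Comparable (MultipleMod k) (toℕ r) (toℕ s)

residuesComparable? : ∀ k .{{_ : NonZero k}} → Dec (ResiduesComparable k)
residuesComparable? k = all? λ r → all? λ s → multipleMod? k _ _ ⊎-dec multipleMod? k _ _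

chainModulus-residues : ∀ k .{{_ : NonZero k}} → ResiduesComparable k → ChainModulus k
chainModulus-residues k comparable i j =
  Sum.map (MultipleMod-residues k) (MultipleMod-residues k)
    (subst₂ (Comparable (MultipleMod k)) (toℕ-fromℕ< (m%n<n i k)) (toℕ-fromℕ< (m%n<n j k))
            (comparable (i mod k) (j mod k)))

chainModulus-3 : ChainModulus 3
chainModulus-3 = chainModulus-residues 3 (toWitness {a? = residuesComparable? 3} _)

chainModulus-4 : ChainModulus 4
chainModulus-4 = chainModulus-residues 4 (toWitness {a? = residuesComparable? 4} _)

chainModulus-5 : ChainModulus 5
chainModulus-5 = chainModulus-residues 5 (toWitness {a? = residuesComparable? 5} _)

module _ {n : ℕ} where

  power-multiple : ∀ (f : Fin n → Fin n) k .{{_ : NonZero k}} → power f k ≗ id →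
                   ∀ {a b} e → e * b % k ≡ a % k → power f a ≗ power (power f b) e
  power-multiple f k fᵏ≗id {a} {b} e eb≡a i = begin
    power f a i            ≡⟨ power-% f k fᵏ≗id a i ⟩
    power f (a % k) i      ≡⟨ cong (λ m → power f m i) (sym eb≡a) ⟩
    power f (e * b % k) i  ≡⟨ power-% f k fᵏ≗id (e * b) i ⟨
    power f (e * b) i      ≡⟨ power-* f b e i ⟨
    power (power f b) e i  ∎
    where open ≡-Reasoning

  IsPowerOf-multiple : ∀ k .{{_ : NonZero k}} {u v w : Alt n} {a b} → power (proj₁ w) k ≗ id →
                       proj₁ u ≗ power (proj₁ w) a → proj₁ v ≗ power (proj₁ w) b →
                       MultipleMod k a b → IsPowerOf u v
  IsPowerOf-multiple k {w = w} wᵏ≗id u≗wᵃ v≗wᵇ (e , eb%k≡a%k) = d , s≤s z≤n , λ i →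
    trans (u≗wᵃ i) (trans (power-multiple (proj₁ w) k wᵏ≗id d eb%k≡a%k i)
                          (sym (power-cong v≗wᵇ d i)))
    where d = suc (toℕ e)

  powers-comparable : ∀ k .{{_ : NonZero k}} → ChainModulus k → {u v w : Alt n} →
                      power (proj₁ w) k ≗ id →
                      IsPowerOf u w → IsPowerOf v w → Comparable IsPowerOf u v
  powers-comparable k chain {u} {v} {w} wᵏ≗id (a , _ , u≗wᵃ) (b , _ , v≗wᵇ) =
    Sum.map (IsPowerOf-multiple k {u} {v} {w} wᵏ≗id u≗wᵃ v≗wᵇ)
            (IsPowerOf-multiple k {v} {u} {w} wᵏ≗id v≗wᵇ u≗wᵃ)
            (chain a b)

inverted : ∀ {n} → (Fin n → Fin n) → Fin n → Fin n → ℕ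
inverted f i j = if ⌊ i <? j ⌋ ∧ ⌊ f j <? f i ⌋ then 1 else 0

inversions-cong : ∀ {n} {f g : Fin n → Fin n} → f ≗ g → inversions f ≡ inversions g
inversions-cong {n} f≗g = cong sum (map-cong (λ i → cong sum (map-cong (λ j →
  cong₂ (λ a b → if ⌊ i <? j ⌋ ∧ ⌊ a <? b ⌋ then 1 else 0) (f≗g j) (f≗g i)) (allFin n))) (allFin n))

sum-allFin-suc : ∀ {m} (g : Fin (suc m) → ℕ) →
                 sum (map g (allFin (suc m))) ≡ g zero + sum (map (g ∘ suc) (allFin m))
sum-allFin-suc g =
  cong (g zero +_) (cong sum (trans (map-tabulate suc g) (sym (map-tabulate id (g ∘ suc)))))

sum-zeros : ∀ {A : Set} (xs : List A) → sum (map (λ _ → 0) xs) ≡ 0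
sum-zeros []       = refl
sum-zeros (_ ∷ xs) = sum-zeros xs

-- ⌊_⌋ does not compute through the map′ inside ℕ._≤?_, but does does.
<?-suc : ∀ {n} (i j : Fin n) → ⌊ suc i <? suc j ⌋ ≡ ⌊ i <? j ⌋
<?-suc i j = trans (isYes≗does (suc i <? suc j)) (sym (isYes≗does (i <? j)))

inversions-lift : ∀ {m} (f : Fin m → Fin m) → inversions (lift 1 f) ≡ inversions f
inversions-lift {m} f = begin
  inversions (lift 1 f)
    ≡⟨ sum-allFin-suc row ⟩
  row zero + sum (map (row ∘ suc) (allFin m))
    ≡⟨ cong₂ _+_ row-zero (cong sum (map-cong row-suc (allFin m))) ⟩
  inversions f
    ∎
  where
  open ≡-Reasoning
  row : Fin (suc m) → ℕ
  row i = sum (map (inverted (lift 1 f) i) (allFin (suc m)))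
  -- Nothing lies below lift 1 f zero = zero, so every entry of row zero reduces to 0.
  row-zero : row zero ≡ 0
  row-zero = trans (sum-allFin-suc (inverted (lift 1 f) zero)) (sum-zeros (allFin m))
  inverted-lift-suc : ∀ i j → inverted (lift 1 f) (suc i) (suc j) ≡ inverted f i j
  inverted-lift-suc i j = cong₂ (λ a b → if a ∧ b then 1 else 0) (<?-suc i j) (<?-suc (f j) (f i))
  row-suc : ∀ i → row (suc i) ≡ sum (map (inverted f i) (allFin m))
  row-suc i = trans (sum-allFin-suc (inverted (lift 1 f) (suc i)))
                    (cong sum (map-cong (inverted-lift-suc i) (allFin m)))

-- Q holds the values not used so far, so non-injective prefixes are discarded as soon as they
-- arise: the enumeration of S₆ below has 720 leaves rather than 6⁶.
allUnique? : ∀ {n} k (Q : Pred (Fin n) 0ℓ) → Decidable Q →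
             (P : Vec (Fin n) k → Set) → (∀ v → Dec (P v)) →
             Dec (∀ v → All Q v → Unique v → P v)
allUnique? zero    Q Q? P P? = map′ (λ p → λ { [] [] [] → p }) (λ h → h [] [] []) (P? [])
allUnique? (suc k) Q Q? P P? = map′
  (λ h → λ { (a ∷ w) (qa ∷ qw) (a∉w ∷ uw) → h a qa w (All.zip (qw , a∉w)) uw })
  (λ h a qa w qw uw → h (a ∷ w) (qa ∷ proj₁ (All.unzip qw)) (proj₂ (All.unzip qw) ∷ uw))
  (all? λ a → Q? a →-dec allUnique? k (λ x → Q x × ¬ a ≡ x) (λ x → Q? x ×-dec ¬? (a ≟ x))
                                     (λ w → P (a ∷ w)) (λ w → P? (a ∷ w)))

identity? : ∀ {n} (f : Fin n → Fin n) → Dec (f ≗ id)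
identity? f = all? λ i → f i ≟ i

Exponent₃₄₅ : ∀ {n} → (Fin n → Fin n) → Set
Exponent₃₄₅ f = power f 3 ≗ id ⊎ power f 4 ≗ id ⊎ power f 5 ≗ id

exponent₃₄₅? : ∀ {n} (f : Fin n → Fin n) → Dec (Exponent₃₄₅ f)
exponent₃₄₅? f = identity? (power f 3) ⊎-dec identity? (power f 4) ⊎-dec identity? (power f 5)

Exponent₃₄₅-cong : ∀ {n} {f g : Fin n → Fin n} → f ≗ g → Exponent₃₄₅ f → Exponent₃₄₅ g
Exponent₃₄₅-cong {f = f} {g} f≗g = Sum.map (transport 3) (Sum.map (transport 4) (transport 5))
  where
  transport : ∀ k → power f k ≗ id → power g k ≗ id
  transport k fᵏ≗id i = trans (sym (power-cong f≗g k i)) (fᵏ≗id i)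

exponent₃₄₅-even-unique-vectors : ∀ (v : Vec (Fin 6) 6) → All (λ _ → ⊤) v → Unique v →
                                  2 ∣ inversions (lookup v) → Exponent₃₄₅ (lookup v)
exponent₃₄₅-even-unique-vectors = toWitness {a? = allUnique? 6 (λ _ → ⊤) (λ _ → yes tt)
  (λ v → 2 ∣ inversions (lookup v) → Exponent₃₄₅ (lookup v))
  (λ v → 2 ∣? inversions (lookup v) →-dec exponent₃₄₅? (lookup v))} _

exponent-A₆ : (u : Alt 6) → Exponent₃₄₅ (proj₁ u)
exponent-A₆ (f , f-injective , even) = Exponent₃₄₅-cong lookup≗f
  (exponent₃₄₅-even-unique-vectors (tabulate f) (All.universal _ _) (tabulate⁺ f-injective)
                                   (subst (2 ∣_) (sym (inversions-cong lookup≗f)) even))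
  where lookup≗f = lookup∘tabulate f

powers-comparable-A₆ : {u v w : Alt 6} → IsPowerOf u w → IsPowerOf v w → Comparable IsPowerOf u v
powers-comparable-A₆ {u} {v} {w} = by-exponent (exponent-A₆ w)
  where
  by-exponent : Exponent₃₄₅ (proj₁ w) → IsPowerOf u w → IsPowerOf v w → Comparable IsPowerOf u v
  by-exponent (inj₁ w³≗id)        = powers-comparable 3 chainModulus-3 {u} {v} {w} w³≗id
  by-exponent (inj₂ (inj₁ w⁴≗id)) = powers-comparable 4 chainModulus-4 {u} {v} {w} w⁴≗id
  by-exponent (inj₂ (inj₂ w⁵≗id)) = powers-comparable 5 chainModulus-5 {u} {v} {w} w⁵≗id

open ChainDownSets (IsPowerOf {6}) (λ {u v w} → IsPowerOf-trans {6} {u} {v} {w})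
                   (λ {u v w} → powers-comparable-A₆ {u} {v} {w})
  using (no-induced-P₄)

module InducedSubgraph {n} {H : Fin 5 → Fin 5 → Set} (G : HasInduced n H) where

  vertex : Fin 5 → Alt n
  vertex = proj₁ G

  edge : ∀ {i j} → i ≢ j → H i j → Comparable IsPowerOf (vertex i) (vertex j)
  edge i≢j = proj₂ ∘ Equivalence.from (proj₂ (proj₂ G) _ _ i≢j)

  non-edge : ∀ {i j} → i ≢ j → ¬ H i j → ¬ Comparable IsPowerOf (vertex i) (vertex j)
  non-edge i≢j ¬ij i~j =
    ¬ij (Equivalence.to (proj₂ (proj₂ G) _ _ i≢j) (proj₁ (proj₂ G) _ _ i≢j , i~j))

P₅-free-A₆ : ¬ HasInduced 6 P5Adj
P₅-free-A₆ G = no-induced-P₄ {vertex (# 0)} {vertex (# 1)} {vertex (# 2)} {vertex (# 3)}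
  (edge {# 0} {# 1} (λ ()) (inj₁ refl))
  (edge {# 1} {# 2} (λ ()) (inj₁ refl))
  (edge {# 2} {# 3} (λ ()) (inj₁ refl))
  (non-edge {# 0} {# 2} (λ ()) λ { (inj₁ ()) ; (inj₂ ()) })
  (non-edge {# 1} {# 3} (λ ()) λ { (inj₁ ()) ; (inj₂ ()) })
  where open InducedSubgraph G

-- The complement of P₅ contains the induced path 1 – 3 – 0 – 2.
co-P₅-free-A₆ : ¬ HasInduced 6 coP5Adj
co-P₅-free-A₆ G = no-induced-P₄ {vertex (# 1)} {vertex (# 3)} {vertex (# 0)} {vertex (# 2)}
  (edge {# 1} {# 3} (λ ()) ((λ ()) , λ { (inj₁ ()) ; (inj₂ ()) }))
  (edge {# 3} {# 0} (λ ()) ((λ ()) , λ { (inj₁ ()) ; (inj₂ ()) }))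
  (edge {# 0} {# 2} (λ ()) ((λ ()) , λ { (inj₁ ()) ; (inj₂ ()) }))
  (non-edge {# 1} {# 0} (λ ()) λ (_ , ¬adjacent) → ¬adjacent (inj₂ refl))
  (non-edge {# 3} {# 2} (λ ()) λ (_ , ¬adjacent) → ¬adjacent (inj₂ refl))
  where open InducedSubgraph G

module _ {m : ℕ} where

  power-lift-zero : ∀ (f : Fin m → Fin m) k → power (lift 1 f) k zero ≡ zero
  power-lift-zero f zero    = refl
  power-lift-zero f (suc k) = cong (lift 1 f) (power-lift-zero f k)

  power-lift-suc : ∀ (f : Fin m → Fin m) k i → power (lift 1 f) k (suc i) ≡ suc (power f k i)
  power-lift-suc f zero    i = refl
  power-lift-suc f (suc k) i = cong (lift 1 f) (power-lift-suc f k i)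

  liftAlt : Alt m → Alt (suc m)
  liftAlt (f , f-injective , even) =
    lift 1 f , lift-injective f f-injective 1 , subst (2 ∣_) (sym (inversions-lift f)) even

  ≈ₐ-lift : {u v : Alt m} → (liftAlt u ≈ₐ liftAlt v) ⇔ (u ≈ₐ v)
  ≈ₐ-lift = mk⇔ (λ u≈v i → suc-injective (u≈v (suc i)))
                (λ { u≈v zero → refl ; u≈v (suc i) → cong suc (u≈v i) })

  IsPowerOf-lift : {u v : Alt m} → IsPowerOf (liftAlt u) (liftAlt v) ⇔ IsPowerOf u v
  IsPowerOf-lift {u} {v} = mk⇔
    (λ (k , 1≤k , u≗vᵏ) → k , 1≤k , λ i →
       suc-injective (trans (u≗vᵏ (suc i)) (power-lift-suc (proj₁ v) k i)))
    (λ (k , 1≤k , u≗vᵏ) → k , 1≤k , λ where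
       zero    → sym (power-lift-zero (proj₁ v) k)
       (suc i) → trans (cong suc (u≗vᵏ i)) (sym (power-lift-suc (proj₁ v) k i)))

  PowAdj-lift : {u v : Alt m} → PowAdj (liftAlt u) (liftAlt v) ⇔ PowAdj u v
  PowAdj-lift {u} {v} =
    ¬-cong-⇔ (≈ₐ-lift {u} {v}) ×-⇔ (IsPowerOf-lift {u} {v} ⊎-⇔ IsPowerOf-lift {v} {u})

  HasInduced-suc : ∀ {H} → HasInduced m H → HasInduced (suc m) H
  HasInduced-suc (f , distinct , adjacency) =
    liftAlt ∘ f ,
    (λ i j i≢j → distinct i j i≢j ∘ Equivalence.to (≈ₐ-lift {f i} {f j})) ,
    (λ i j i≢j → ⇔-trans (PowAdj-lift {f i} {f j}) (adjacency i j i≢j))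

HasInduced-mono : ∀ {m n H} → m ≤ n → HasInduced m H → HasInduced n H
HasInduced-mono = go ∘ ≤⇒≤′
  where
  go : ∀ {m n H} → m ≤′ n → HasInduced m H → HasInduced n H
  go ≤′-refl        = id
  go (≤′-step m≤′n) = HasInduced-suc ∘ go m≤′n

_⇔-dec_ : ∀ {A B : Set} → Dec A → Dec B → Dec (A ⇔ B)
a? ⇔-dec b? = map′ (λ (to , from) → mk⇔ to from) (λ a⇔b → Equivalence.to a⇔b , Equivalence.from a⇔b)
                   ((a? →-dec b?) ×-dec (b? →-dec a?))

injective? : ∀ {n} (f : Fin n → Fin n) → Dec (Injective _≡_ _≡_ f)
injective? f =
  map′ (λ h {i} {j} → h i j) (λ h i j → h) (all? λ i → all? λ j → f i ≟ f j →-dec i ≟ j)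

alternating : ∀ {n} (f : Fin n → Fin n) → {True (injective? f)} → {True (2 ∣? inversions f)} → Alt n
alternating f {injective} {even} = f , toWitness injective , toWitness even

module _ {n : ℕ} where

  ≈ₐ? : (u v : Alt n) → Dec (u ≈ₐ v)
  ≈ₐ? u v = all? λ i → proj₁ u i ≟ proj₁ v i

  IsPowerOf? : ∀ k .{{_ : NonZero k}} (u v : Alt n) → power (proj₁ v) k ≗ id → Dec (IsPowerOf u v)
  IsPowerOf? k u v vᵏ≗id =
    map′ witness bounded (any? λ r → all? λ i → proj₁ u i ≟ power (proj₁ v) (k + toℕ r) i)
    where
    g = proj₁ v
    witness : (∃ λ (r : Fin k) → proj₁ u ≗ power g (k + toℕ r)) → IsPowerOf u v
    witness (r , u≗gᵏ⁺ʳ) = k + toℕ r , ≤-trans (>-nonZero⁻¹ k) (m≤m+n k (toℕ r)) , u≗gᵏ⁺ʳ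
    bounded : IsPowerOf u v → ∃ λ (r : Fin k) → proj₁ u ≗ power g (k + toℕ r)
    bounded (e , _ , u≗gᵉ) = e mod k , λ i → begin
      proj₁ u i                              ≡⟨ u≗gᵉ i ⟩
      power g e i                            ≡⟨ power-% g k vᵏ≗id e i ⟩
      power g (e % k) i                      ≡⟨ cong (λ d → power g d i) (toℕ-fromℕ< (m%n<n e k)) ⟨
      power g (toℕ (e mod k)) i              ≡⟨ vᵏ≗id _ ⟨
      power g k (power g (toℕ (e mod k)) i)  ≡⟨ power-+ g k _ i ⟨
      power g (k + toℕ (e mod k)) i          ∎
      where open ≡-Reasoning

  PowAdj? : ∀ k .{{_ : NonZero k}} (u v : Alt n) → power (proj₁ u) k ≗ id → power (proj₁ v) k ≗ id →
            Dec (PowAdj u v)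
  PowAdj? k u v uᵏ≗id vᵏ≗id =
    ¬? (≈ₐ? u v) ×-dec (IsPowerOf? k u v vᵏ≗id ⊎-dec IsPowerOf? k v u uᵏ≗id)

P5Adj? : ∀ i j → Dec (P5Adj i j)
P5Adj? i j = toℕ j ℕ.≟ suc (toℕ i) ⊎-dec toℕ i ℕ.≟ suc (toℕ j)

c t s : Fin 7 → Fin 7
c = lookup (# 1 ∷ # 2 ∷ # 0 ∷ # 3 ∷ # 4 ∷ # 5 ∷ # 6 ∷ [])
t = lookup (# 0 ∷ # 1 ∷ # 2 ∷ # 4 ∷ # 3 ∷ # 6 ∷ # 5 ∷ [])
s = lookup (# 0 ∷ # 1 ∷ # 2 ∷ # 5 ∷ # 6 ∷ # 3 ∷ # 4 ∷ [])

P₅-in-A₇ : HasInduced 7 P5Adj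
P₅-in-A₇ = vertex , distinct , adjacency
  where
  vertex : Fin 5 → Alt 7
  vertex = lookup (alternating t ∷ alternating (c ∘ t) ∷ alternating c ∷
                   alternating (c ∘ s) ∷ alternating s ∷ [])
  order-divides-6 : ∀ i → power (proj₁ (vertex i)) 6 ≗ id
  order-divides-6 = toWitness {a? = all? λ i → identity? (power (proj₁ (vertex i)) 6)} _
  distinct : ∀ i j → i ≢ j → ¬ (vertex i ≈ₐ vertex j)
  distinct = toWitness
    {a? = all? λ i → all? λ j → ¬? (i ≟ j) →-dec ¬? (≈ₐ? (vertex i) (vertex j))} _
  adjacency : ∀ i j → i ≢ j → PowAdj (vertex i) (vertex j) ⇔ P5Adj i j
  adjacency = toWitness {a? = all? λ i → all? λ j → ¬? (i ≟ j) →-dec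
    (PowAdj? 6 (vertex i) (vertex j) (order-divides-6 i) (order-divides-6 j) ⇔-dec P5Adj? i j)} _

mainTheorem13 : (n : ℕ) → 1 ≤ n → (PowerGraphP5coP5Free n ⇔ n ≤ 6)
mainTheorem13 n _ = mk⇔ free⇒≤6 ≤6⇒free
  where
  free⇒≤6 : PowerGraphP5coP5Free n → n ≤ 6
  free⇒≤6 (P₅-free , _) = ≮⇒≥ λ 6<n → P₅-free (HasInduced-mono 6<n P₅-in-A₇)
  ≤6⇒free : n ≤ 6 → PowerGraphP5coP5Free n
  ≤6⇒free n≤6 = P₅-free-A₆ ∘ HasInduced-mono n≤6 , co-P₅-free-A₆ ∘ HasInduced-mono n≤6
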